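{- There is no pointed ordered $\lambda$-model with more than one element that satisfies both equations $\Theta x x = \Omega$ and $\Theta x\Omega = x$.
   Context: $\Omega \equiv (\lambda x.xx)(\lambda x.xx)$, $B \equiv \lambda x.x(\lambda y.yx)$, $C \equiv \lambda z.zB$, $\Theta \equiv BC$. A combinatory algebra is a structure $(A,\cdot,K,S)$ with a binary operation (application, associating to the left) satisfying $Kxy=x$ and $Sxyz=xz(yz)$. Let $I\equiv SKK$, $\varepsilon_1\equiv\varepsilon \equiv S(KI)$, $\varepsilon_{n+1}\equiv S(K\varepsilon)(S(K\varepsilon_n))$. A $\lambda$-model is a combinatory algebra satisfying moreover $\forall x y((\forall z.\ xz=yz)\Rightarrow \varepsilon x=\varepsilon y)$, $\varepsilon_2K=K$ and $\varepsilon_3 S=S$; $\lambda$-terms are interpreted in it in the standard way relative to environments ($|x|_\rho=\rho(x)$, $|MN|_\rho=|M|_\rho|N|_\rho$, $|\lambda x.M|_\rho=\varepsilon a$ for any $a$ representing $b\mapsto |M|_{\rho[x:=b]}$), and the model satisfies an equation $M=N$ if $|M|_\rho=|N|_\rho$ for all environments $\rho$. An ordered $\lambda$-model is a $\lambda$-model together with a partial order on its carrier making application monotone in both arguments; it is pointed if the partial order has a least element. -}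

module Defs where

open import Level using (Level; _⊔_; suc)
open import Data.Nat using (ℕ; zero; suc; _≟_)
open import Data.Product using (Σ; ∃; _×_; _,_)
open import Relation.Nullary using (¬_; yes; no)
open import Relation.Binary.Core using (Rel)
open import Relation.Binary.Structures using (IsPartialOrder)
open import Relation.Binary.PropositionalEquality using (_≡_; _≢_)

record CombinatoryAlgebra (a : Level) : Set (Level.suc a) where
  infixl 9 _·_
  field
    Carrier : Set a
    _·_     : Carrier → Carrier → Carrier
    K S     : Carrier
    K-law   : ∀ x y → K · x · y ≡ x
    S-law   : ∀ x y z → S · x · y · z ≡ x · z · (y · z)

  I : Carrier
  I = S · K · K

  ε : Carrier
  ε = S · (K · I)

  -- ε-index n stands for ε_{n+1}
  ε-index : ℕ → Carrier
  ε-index zero    = ε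
  ε-index (suc n) = S · (K · ε) · (S · (K · ε-index n))

  ε₁ ε₂ ε₃ : Carrier
  ε₁ = ε-index 0
  ε₂ = ε-index 1
  ε₃ = ε-index 2

record LambdaModel (a : Level) : Set (Level.suc a) where
  field
    ca : CombinatoryAlgebra a
  open CombinatoryAlgebra ca public
  field
    weak-ext : ∀ x y → (∀ z → x · z ≡ y · z) → ε · x ≡ ε · y
    ε₂K      : ε₂ · K ≡ K
    ε₃S      : ε₃ · S ≡ S

record OrderedLambdaModel (a ℓ : Level) : Set (Level.suc (a ⊔ ℓ)) where
  field
    lm : LambdaModel a
  open LambdaModel lm public
  field
    _≤_            : Rel Carrier ℓ
    isPartialOrder : IsPartialOrder _≡_ _≤_
    ·-mono         : ∀ {x x′ y y′} → x ≤ x′ → y ≤ y′ → (x · y) ≤ (x′ · y′)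

Pointed : ∀ {a ℓ} → OrderedLambdaModel a ℓ → Set (a ⊔ ℓ)
Pointed M = Σ Carrier λ b → ∀ x → b ≤ x
  where open OrderedLambdaModel M

Nontrivial : ∀ {a ℓ} → OrderedLambdaModel a ℓ → Set a
Nontrivial M = Σ Carrier λ x → Σ Carrier λ y → x ≢ y
  where open OrderedLambdaModel M

Var : Set
Var = ℕ

data Λ : Set where
  var : Var → Λ
  _$_ : Λ → Λ → Λ
  lam : Var → Λ → Λ

data CL : Set where
  var : Var → CL
  _$_ : CL → CL → CL
  K S : CL

I-CL ε-CL : CL
I-CL = (S $ K) $ K
ε-CL = S $ (K $ I-CL)

-- bracket abstraction λ*x.P  (satisfies (λ*x.P) b = P[x:=b] in any CA)
abs : Var → CL → CL
abs x (var y) with x ≟ y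
... | yes _ = I-CL
... | no _  = K $ var y
abs x (P $ Q) = (S $ abs x P) $ abs x Q
abs x K = K $ K
abs x S = K $ S

toCL : Λ → CL
toCL (var x)   = var x
toCL (M $ N)   = toCL M $ toCL N
toCL (lam x M) = ε-CL $ abs x (toCL M)

module Interp {a} (A : CombinatoryAlgebra a) where
  open CombinatoryAlgebra A

  ⟦_⟧CL : CL → (Var → Carrier) → Carrier
  ⟦ var x ⟧CL ρ = ρ x
  ⟦ P $ Q ⟧CL ρ = ⟦ P ⟧CL ρ · ⟦ Q ⟧CL ρ
  ⟦ K ⟧CL ρ = CombinatoryAlgebra.K A
  ⟦ S ⟧CL ρ = CombinatoryAlgebra.S A

  -- |M|_ρ ; in particular |λx.M|_ρ = ε · a where a = |λ*x.M_CL|_ρ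
  -- represents b ↦ |M|_{ρ[x:=b]}
  ⟦_⟧ : Λ → (Var → Carrier) → Carrier
  ⟦ M ⟧ ρ = ⟦ toCL M ⟧CL ρ

_⊨_≐_ : ∀ {a ℓ} → OrderedLambdaModel a ℓ → Λ → Λ → Set a
M ⊨ P ≐ Q = ∀ (ρ : Var → OrderedLambdaModel.Carrier M) → ⟦ P ⟧ ρ ≡ ⟦ Q ⟧ ρ
  where open Interp (LambdaModel.ca (OrderedLambdaModel.lm M))

x y z : Var
x = 0
y = 1
z = 2

Ω-t B-t C-t Θ-t : Λ
Ω-t = lam x (var x $ var x) $ lam x (var x $ var x)
B-t = lam x (var x $ lam y (var y $ var x))
C-t = lam z (var z $ B-t)
Θ-t = B-t $ C-t

module Submission where

-- With least element ⊥, the equations give Ω = Θ⊥⊥ ≤ Θ⊥Ω = ⊥, hence Ω ≤ w for every w, and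
-- then w = ΘwΩ ≤ Θww = Ω ≤ ⊥ by monotonicity; so every element equals ⊥.

open import Defs
open import Level using (Level)
open import Data.Product using (_×_; _,_)
open import Relation.Nullary using (¬_)
open import Relation.Binary.Core using (Rel)
open import Relation.Binary.Structures using (IsPartialOrder)
open import Relation.Binary.PropositionalEquality using (_≡_; sym; trans; subst₂)

module MonotoneApplication
  {a ℓ} {A : Set a} {_≤_ : Rel A ℓ} (isPartialOrder : IsPartialOrder _≡_ _≤_)
  (_·_ : A → A → A) (·-mono : ∀ {x x′ y y′} → x ≤ x′ → y ≤ y′ → (x · y) ≤ (x′ · y′))
  where

  open IsPartialOrder isPartialOrder using (antisym) renaming (refl to ≤-refl; trans to ≤-trans)

  everything≡least : (⊥ : A) → (∀ w → ⊥ ≤ w) → (t o : A) →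
    (∀ w → (t · w) · w ≡ o) → (∀ w → (t · w) · o ≡ w) → ∀ w → w ≡ ⊥
  everything≡least ⊥ ⊥≤ t o tww≡o two≡w w = antisym (≤-trans w≤o o≤⊥) (⊥≤ w)
    where
    o≤⊥ : o ≤ ⊥
    o≤⊥ = subst₂ _≤_ (tww≡o ⊥) (two≡w ⊥) (·-mono ≤-refl (⊥≤ o))

    w≤o : w ≤ o
    w≤o = subst₂ _≤_ (two≡w w) (tww≡o w) (·-mono ≤-refl (≤-trans o≤⊥ (⊥≤ w)))

theorem3p2 : ∀ {a ℓ : Level} (M : OrderedLambdaModel a ℓ) →
    Pointed M → Nontrivial M →
    ¬ ((M ⊨ (Θ-t $ var x) $ var x ≐ Ω-t) × (M ⊨ (Θ-t $ var x) $ Ω-t ≐ var x))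
theorem3p2 M (⊥ , ⊥≤) (u , v , u≢v) (Θxx≐Ω , ΘxΩ≐x) =
  u≢v (trans (collapse u) (sym (collapse v)))
  where
  open OrderedLambdaModel M
  open Interp ca
  open MonotoneApplication isPartialOrder _·_ ·-mono

  const : Carrier → Var → Carrier
  const w _ = w

  -- Θ and Ω are closed, so their denotations under const w and const ⊥ agree definitionally.
  Θ Ω : Carrier
  Θ = ⟦ Θ-t ⟧ (const ⊥)
  Ω = ⟦ Ω-t ⟧ (const ⊥)

  collapse : ∀ w → w ≡ ⊥
  collapse = everything≡least ⊥ ⊥≤ Θ Ω (λ w → Θxx≐Ω (const w)) (λ w → ΘxΩ≐x (const w))
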